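{- Let $\varphi,\varphi',\varphi''$ be formulas and $W=\textsf{Var}(\varphi')\setminus\textsf{Var}(\varphi)$. If $\varphi\Rightarrow^{*}_{\mathrm{BVA}}\varphi'$ and $\varphi'\cong_W\varphi''$, then $\varphi\Rightarrow^{*}_{\mathrm{BVA}}\varphi''$.
   Context: A literal is a variable or its negation; a clause is a set of non-complementary literals; a formula is a set of clauses; $\textsf{Var}(\cdot)$ is the set of variables occurring. BVA step: for a formula $\varphi$, sets $\mathcal{C},\mathcal{D}$ of nonempty clauses with $\mathcal{C}\bowtie\mathcal{D}:=\{C\cup D: C\in\mathcal{C},D\in\mathcal{D}\}\subseteq\varphi$ and a fresh variable $y\notin\textsf{Var}(\varphi)$, the formula $(\varphi\setminus(\mathcal{C}\bowtie\mathcal{D}))\cup\{C\cup\{y\}:C\in\mathcal{C}\}\cup\{\{\overline{y}\}\cup D:D\in\mathcal{D}\}$ is derived in one BVA step; $\Rightarrow^{*}_{\mathrm{BVA}}$ is the reflexive transitive closure of this relation. For formulas $\psi,\psi'$ and a set $W$ of variables, $\psi\cong_W\psi'$ means $\psi'$ can be obtained from $\psi$ by replacing some variables from $W$ by their negations wherever they appear. -}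

module Defs where

open import Data.Nat using (ℕ)
open import Data.Bool using (Bool; true; false; not; if_then_else_)
open import Data.Product using (Σ; ∃; _×_; _,_; proj₁; proj₂)
open import Data.Sum using (_⊎_)
open import Data.List using (List; []; _∷_; _++_; map)
open import Data.List.Membership.Propositional using (_∈_)
open import Relation.Nullary using (¬_)
open import Relation.Binary.PropositionalEquality using (_≡_)
open import Relation.Binary.Construct.Closure.ReflexiveTransitive using (Star)
open import Function.Bundles using (_⇔_)

Var : Set
Var = ℕ

-- A literal: (x , true) is the variable x, (x , false) is its negation x̄.
Literal : Set
Literal = Var × Bool

-- A clause is a finite SET of literals, represented by a list
-- (order and repetitions are irrelevant; see _≈ᶜ_).
Clause : Set
Clause = List Literal

-- A formula is a finite SET of clauses, represented by a list
-- (compared up to _≈ᶠ_).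
Formula : Set
Formula = List Clause

_≈ᶜ_ : Clause → Clause → Set
C ≈ᶜ D = ∀ l → (l ∈ C) ⇔ (l ∈ D)

_∈ᶠ_ : Clause → Formula → Set
C ∈ᶠ φ = ∃ λ C′ → (C′ ∈ φ) × (C ≈ᶜ C′)

_≈ᶠ_ : Formula → Formula → Set
φ ≈ᶠ ψ = ∀ C → (C ∈ᶠ φ) ⇔ (C ∈ᶠ ψ)

NonComplementary : Clause → Set
NonComplementary C = ∀ x → ¬ (((x , true) ∈ C) × ((x , false) ∈ C))

NonEmpty : Clause → Set
NonEmpty C = ∃ λ l → l ∈ C

WellFormed : Formula → Set
WellFormed φ = ∀ C → C ∈ φ → NonComplementary C

_∈Var_ : Var → Formula → Set
x ∈Var φ = ∃ λ C → (C ∈ φ) × ∃ λ b → (x , b) ∈ C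

_∈⋈_,_ : Clause → List Clause → List Clause → Set
E ∈⋈ 𝒞 , 𝒟 = ∃ λ C → ∃ λ D → (C ∈ 𝒞) × (D ∈ 𝒟) × (E ≈ᶜ (C ++ D))

-- One BVA step φ ⇒ ψ: there are sets 𝒞, 𝒟 of nonempty clauses with
-- 𝒞 ⋈ 𝒟 ⊆ φ and a fresh variable y ∉ Var(φ) such that ψ is (as a set)
-- (φ ∖ (𝒞 ⋈ 𝒟)) ∪ {C ∪ {y} : C ∈ 𝒞} ∪ {{ȳ} ∪ D : D ∈ 𝒟}.
record BVAStep (φ ψ : Formula) : Set where
  field
    𝒞 𝒟 : List Clause
    y : Var
    𝒞-clauses : ∀ C → C ∈ 𝒞 → NonEmpty C × NonComplementary C
    𝒟-clauses : ∀ D → D ∈ 𝒟 → NonEmpty D × NonComplementary D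
    ⋈-⊆ : ∀ C D → C ∈ 𝒞 → D ∈ 𝒟 → (C ++ D) ∈ᶠ φ
    fresh : ¬ (y ∈Var φ)
    result : ∀ E → (E ∈ᶠ ψ) ⇔
      (((E ∈ᶠ φ) × ¬ (E ∈⋈ 𝒞 , 𝒟))
       ⊎ (∃ λ C → (C ∈ 𝒞) × (E ≈ᶜ ((y , true) ∷ C)))
       ⊎ (∃ λ D → (D ∈ 𝒟) × (E ≈ᶜ ((y , false) ∷ D))))

_⇒*BVA_ : Formula → Formula → Set
φ ⇒*BVA ψ = ∃ λ χ → Star BVAStep φ χ × (χ ≈ᶠ ψ)

flipLit : (Var → Bool) → Literal → Literal
flipLit S (x , b) = x , (if S x then not b else b)

_≅[_]_ : Formula → (Var → Set) → Formula → Set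
ψ ≅[ W ] ψ′ = ∃ λ (S : Var → Bool) →
  (∀ x → S x ≡ true → W x) × (ψ′ ≈ᶠ map (map (flipLit S)) ψ)

NewVars : Formula → Formula → Var → Set
NewVars φ φ′ x = (x ∈Var φ′) × ¬ (x ∈Var φ)

module Submission where

-- Negating a set S of variables is an involution on literals that maps every
-- BVA step to a BVA step: the fresh variable y stays fresh, and if y ∈ S the
-- roles of 𝒞 and 𝒟 are exchanged.  Hence a BVA derivation φ ⇒* χ is carried
-- to a derivation of the flipped formulas, and when no variable of S occurs in
-- φ the flipped start is φ itself.

open import Defs
open import Data.Bool using (Bool; true; false; _xor_)
open import Data.Bool.Properties using (not-involutive)
open import Data.Product using (∃; _×_; _,_; proj₂)
open import Data.Product.Function.NonDependent.Propositional using (_×-⇔_)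
open import Data.Sum using (_⊎_; inj₁; inj₂)
open import Data.Sum.Function.Propositional using (_⊎-⇔_)
open import Data.List using (List; _∷_; _++_; map)
open import Data.List.Properties using (map-++; map-∘; map-cong; map-id; map-id-local)
open import Data.List.Membership.Propositional using (_∈_)
open import Data.List.Membership.Propositional.Properties using (∈-map⁺; ∈-map⁻)
open import Data.List.Relation.Unary.All using (tabulate)
open import Data.List.Relation.Unary.Any.Properties using (++-comm)
open import Relation.Nullary using (¬_)
open import Data.Empty using (⊥-elim)
open import Relation.Binary.PropositionalEquality using (_≡_; refl; sym; trans; cong; subst)
open import Relation.Binary.Construct.Closure.ReflexiveTransitive using (Star; gmap)
open import Function.Bundles using (_⇔_; mk⇔; Equivalence)
open import Function.Related.TypeIsomorphisms using (¬-cong-⇔)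
import Function.Properties.Equivalence as ⇔

open Equivalence using (to; from)

≈ᶜ-refl : ∀ {C} → C ≈ᶜ C
≈ᶜ-refl _ = ⇔.refl

≈ᶜ-trans : ∀ {C D E} → C ≈ᶜ D → D ≈ᶜ E → C ≈ᶜ E
≈ᶜ-trans p q l = ⇔.trans (p l) (q l)

≈ᶠ-sym : ∀ {φ ψ} → φ ≈ᶠ ψ → ψ ≈ᶠ φ
≈ᶠ-sym p C = ⇔.sym (p C)

≈ᶠ-trans : ∀ {φ ψ χ} → φ ≈ᶠ ψ → ψ ≈ᶠ χ → φ ≈ᶠ χ
≈ᶠ-trans p q C = ⇔.trans (p C) (q C)

⇒*BVA-resp-≈ᶠ : ∀ {φ ψ ψ′} → φ ⇒*BVA ψ → ψ ≈ᶠ ψ′ → φ ⇒*BVA ψ′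
⇒*BVA-resp-≈ᶠ (χ , steps , χ≈ψ) ψ≈ψ′ = χ , steps , ≈ᶠ-trans χ≈ψ ψ≈ψ′

xor-involutiveˡ : ∀ s b → s xor (s xor b) ≡ b
xor-involutiveˡ true  b = not-involutive b
xor-involutiveˡ false b = refl

module _ {A : Set} {f : A → A} (f-involutive : ∀ x → f (f x) ≡ x) where

  map-involutive : ∀ xs → map f (map f xs) ≡ xs
  map-involutive xs = trans (sym (map-∘ xs)) (trans (map-cong f-involutive xs) (map-id xs))

  ∈-map-involutive : ∀ {x xs} → x ∈ map f xs → f x ∈ xs
  ∈-map-involutive m with ∈-map⁻ f m
  ... | a , a∈xs , refl = subst (_∈ _) (sym (f-involutive a)) a∈xs

-- The sets 𝒞 and 𝒟 of a BVA step, indexed by the polarity of the fresh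
-- literal their clauses receive.
sides : List Clause → List Clause → Bool → List Clause
sides 𝒞 𝒟 true  = 𝒞
sides 𝒞 𝒟 false = 𝒟

Marked : Var → (Bool → List Clause) → Clause → Set
Marked y 𝒮 E = ∃ λ b → ∃ λ C → (C ∈ 𝒮 b) × (E ≈ᶜ ((y , b) ∷ C))

⊎⇔Marked : ∀ {y E} (𝒮 : Bool → List Clause) →
  ((∃ λ C → (C ∈ 𝒮 true) × (E ≈ᶜ ((y , true) ∷ C)))
   ⊎ (∃ λ D → (D ∈ 𝒮 false) × (E ≈ᶜ ((y , false) ∷ D)))) ⇔ Marked y 𝒮 E
⊎⇔Marked _ = mk⇔ (λ { (inj₁ p) → true , p ; (inj₂ q) → false , q })
                 (λ { (true , p) → inj₁ p ; (false , q) → inj₂ q })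

∈⋈-comm : ∀ {E 𝒞 𝒟} → E ∈⋈ 𝒞 , 𝒟 → E ∈⋈ 𝒟 , 𝒞
∈⋈-comm (C , D , C∈𝒞 , D∈𝒟 , E≈C++D) =
  D , C , D∈𝒟 , C∈𝒞 , ≈ᶜ-trans E≈C++D (λ _ → mk⇔ (++-comm C D) (++-comm D C))

∈⋈-xor : ∀ {E} (𝒮 : Bool → List Clause) s →
  (E ∈⋈ 𝒮 (s xor true) , 𝒮 (s xor false)) ⇔ (E ∈⋈ 𝒮 true , 𝒮 false)
∈⋈-xor 𝒮 true  = mk⇔ ∈⋈-comm ∈⋈-comm
∈⋈-xor 𝒮 false = ⇔.refl

∈⋈⇒∈ᶠ : ∀ {φ ψ E} (st : BVAStep φ ψ) → E ∈⋈ BVAStep.𝒞 st , BVAStep.𝒟 st → E ∈ᶠ φ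
∈⋈⇒∈ᶠ st (C , D , C∈𝒞 , D∈𝒟 , E≈C++D) with BVAStep.⋈-⊆ st C D C∈𝒞 D∈𝒟
... | C′ , C′∈φ , C++D≈C′ = C′ , C′∈φ , ≈ᶜ-trans E≈C++D C++D≈C′

module Flip (S : Var → Bool) where

  flipClause : Clause → Clause
  flipClause = map (flipLit S)

  flipFormula : Formula → Formula
  flipFormula = map flipClause

  flipLit-xor : ∀ x b → flipLit S (x , b) ≡ (x , S x xor b)
  flipLit-xor x b with S x
  ... | true  = refl
  ... | false = refl

  flipLit-involutive : ∀ l → flipLit S (flipLit S l) ≡ l
  flipLit-involutive (x , b) with S x
  ... | true  = cong (x ,_) (not-involutive b)
  ... | false = refl

  flipClause-involutive : ∀ C → flipClause (flipClause C) ≡ C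
  flipClause-involutive = map-involutive flipLit-involutive

  flipClause-∷ : ∀ x b C → flipClause ((x , b) ∷ C) ≡ (x , S x xor b) ∷ flipClause C
  flipClause-∷ x b C = cong (_∷ flipClause C) (flipLit-xor x b)

  flip-∈ : ∀ {x b C} → (x , b) ∈ C → (x , S x xor b) ∈ flipClause C
  flip-∈ {x} {b} m = subst (_∈ _) (flipLit-xor x b) (∈-map⁺ (flipLit S) m)

  flipClause-cong : ∀ {C D} → C ≈ᶜ D → flipClause C ≈ᶜ flipClause D
  flipClause-cong C≈D l = mk⇔ (transport (to (C≈D (flipLit S l))))
                              (transport (from (C≈D (flipLit S l))))
    where
    transport : ∀ {C D} → (flipLit S l ∈ C → flipLit S l ∈ D) →
                l ∈ flipClause C → l ∈ flipClause D
    transport f m = subst (_∈ _) (flipLit-involutive l)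
                          (∈-map⁺ (flipLit S) (f (∈-map-involutive flipLit-involutive m)))

  flipClause-transpose : ∀ {C D} → flipClause C ≈ᶜ D → C ≈ᶜ flipClause D
  flipClause-transpose {C} fC≈D =
    subst (_≈ᶜ _) (flipClause-involutive C) (flipClause-cong fC≈D)

  ∈ᶠ-flip : ∀ {E φ} → (E ∈ᶠ flipFormula φ) ⇔ (flipClause E ∈ᶠ φ)
  ∈ᶠ-flip = mk⇔
    (λ { (C , C∈fφ , E≈C) →
           flipClause C , ∈-map-involutive flipClause-involutive C∈fφ , flipClause-cong E≈C })
    (λ { (C , C∈φ , fE≈C) →
           flipClause C , ∈-map⁺ flipClause C∈φ , flipClause-transpose fE≈C })

  flipFormula-cong : ∀ {φ ψ} → φ ≈ᶠ ψ → flipFormula φ ≈ᶠ flipFormula ψ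
  flipFormula-cong φ≈ψ C = ⇔.trans ∈ᶠ-flip (⇔.trans (φ≈ψ (flipClause C)) (⇔.sym ∈ᶠ-flip))

  ∈Var-flip : ∀ {x φ} → x ∈Var flipFormula φ → x ∈Var φ
  ∈Var-flip (C , C∈fφ , b , x∈C) =
    flipClause C , ∈-map-involutive flipClause-involutive C∈fφ , _ , ∈-map⁺ (flipLit S) x∈C

  nonEmpty-flip : ∀ {C} → NonEmpty (flipClause C) → NonEmpty C
  nonEmpty-flip (l , l∈fC) = flipLit S l , ∈-map-involutive flipLit-involutive l∈fC

  nonComplementary-flip : ∀ {C} → NonComplementary (flipClause C) → NonComplementary C
  nonComplementary-flip nc x (p , q) with S x | flip-∈ p | flip-∈ q
  ... | true  | p′ | q′ = nc x (q′ , p′)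
  ... | false | p′ | q′ = nc x (p′ , q′)

  clauses-flip : ∀ {𝒞} → (∀ C → C ∈ 𝒞 → NonEmpty C × NonComplementary C) →
                 ∀ C → C ∈ map flipClause 𝒞 → NonEmpty C × NonComplementary C
  clauses-flip h C C∈f𝒞 with h (flipClause C) (∈-map-involutive flipClause-involutive C∈f𝒞)
  ... | ne , nc = nonEmpty-flip ne , nonComplementary-flip nc

  ∈⋈-flip : ∀ {E 𝒞 𝒟} → (E ∈⋈ map flipClause 𝒞 , map flipClause 𝒟) ⇔ (flipClause E ∈⋈ 𝒞 , 𝒟)
  ∈⋈-flip = mk⇔
    (λ { (C , D , C∈f𝒞 , D∈f𝒟 , E≈C++D) →
           flipClause C , flipClause D ,
           ∈-map-involutive flipClause-involutive C∈f𝒞 ,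
           ∈-map-involutive flipClause-involutive D∈f𝒟 ,
           subst (_ ≈ᶜ_) (map-++ (flipLit S) C D) (flipClause-cong E≈C++D) })
    (λ { (C , D , C∈𝒞 , D∈𝒟 , fE≈C++D) →
           flipClause C , flipClause D , ∈-map⁺ flipClause C∈𝒞 , ∈-map⁺ flipClause D∈𝒟 ,
           subst (_ ≈ᶜ_) (map-++ (flipLit S) C D) (flipClause-transpose fE≈C++D) })

  -- 𝒮 (S y xor b) receives the literal (y , b) once y has been flipped.
  reoriented : Var → (Bool → List Clause) → Bool → List Clause
  reoriented y 𝒮 b = map flipClause (𝒮 (S y xor b))

  Marked-flip : ∀ {y E} (𝒮 : Bool → List Clause) →
                Marked y 𝒮 (flipClause E) ⇔ Marked y (reoriented y 𝒮) E
  Marked-flip {y} {E} 𝒮 = mk⇔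
    (λ { (b , C , C∈𝒮b , fE≈yC) →
           S y xor b , flipClause C ,
           subst (λ c → flipClause C ∈ map flipClause (𝒮 c)) (sym (xor-involutiveˡ (S y) b))
                 (∈-map⁺ flipClause C∈𝒮b) ,
           subst (E ≈ᶜ_) (flipClause-∷ y b C) (flipClause-transpose fE≈yC) })
    (λ { (b , C , C∈𝒮′b , E≈yC) →
           S y xor b , flipClause C , ∈-map-involutive flipClause-involutive C∈𝒮′b ,
           subst (flipClause E ≈ᶜ_) (flipClause-∷ y b C) (flipClause-cong E≈yC) })

  flip-BVAStep : ∀ {φ ψ} → BVAStep φ ψ → BVAStep (flipFormula φ) (flipFormula ψ)
  flip-BVAStep {φ} {ψ} st = record
    { 𝒞         = 𝒮′ true
    ; 𝒟         = 𝒮′ false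
    ; y         = y
    ; 𝒞-clauses = clauses-flip (sides-clauses (S y xor true))
    ; 𝒟-clauses = clauses-flip (sides-clauses (S y xor false))
    ; ⋈-⊆       = λ C D C∈𝒞′ D∈𝒟′ →
        from ∈ᶠ-flip (∈⋈⇒∈ᶠ st (to joined-flip (C , D , C∈𝒞′ , D∈𝒟′ , ≈ᶜ-refl)))
    ; fresh     = λ y∈fφ → fresh (∈Var-flip y∈fφ)
    ; result    = λ E →
        ⇔.trans ∈ᶠ-flip (⇔.trans (result (flipClause E))
          ((⇔.sym ∈ᶠ-flip ×-⇔ ¬-cong-⇔ (⇔.sym joined-flip))
           ⊎-⇔ ⇔.trans (⊎⇔Marked 𝒮) (⇔.trans (Marked-flip 𝒮) (⇔.sym (⊎⇔Marked 𝒮′)))))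
    }
    where
    open BVAStep st
    𝒮 𝒮′ : Bool → List Clause
    𝒮 = sides 𝒞 𝒟
    𝒮′ = reoriented y 𝒮

    sides-clauses : ∀ b C → C ∈ 𝒮 b → NonEmpty C × NonComplementary C
    sides-clauses true  = 𝒞-clauses
    sides-clauses false = 𝒟-clauses

    joined-flip : ∀ {E} → (E ∈⋈ 𝒮′ true , 𝒮′ false) ⇔ (flipClause E ∈⋈ 𝒞 , 𝒟)
    joined-flip = ⇔.trans ∈⋈-flip (∈⋈-xor 𝒮 (S y))

  flipFormula-id : ∀ φ → (∀ x → S x ≡ true → ¬ (x ∈Var φ)) → flipFormula φ ≡ φ
  flipFormula-id φ unflipped =
    map-id-local (tabulate λ C∈φ → map-id-local (tabulate (flipLit-id C∈φ)))
    where
    flipLit-id : ∀ {C x b} → C ∈ φ → (x , b) ∈ C → flipLit S (x , b) ≡ (x , b)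
    flipLit-id {C} {x} {b} C∈φ x∈C with S x in Sx
    ... | true  = ⊥-elim (unflipped x Sx (C , C∈φ , b , x∈C))
    ... | false = refl

  ⇒*BVA-flip : ∀ {φ ψ} → (∀ x → S x ≡ true → ¬ (x ∈Var φ)) →
               φ ⇒*BVA ψ → φ ⇒*BVA flipFormula ψ
  ⇒*BVA-flip {φ} unflipped (χ , steps , χ≈ψ) =
    flipFormula χ ,
    subst (λ ξ → Star BVAStep ξ (flipFormula χ)) (flipFormula-id φ unflipped)
          (gmap flipFormula flip-BVAStep steps) ,
    flipFormula-cong χ≈ψ

open Flip using (⇒*BVA-flip)

lemma40 : (φ φ′ φ″ : Formula) →
          WellFormed φ → WellFormed φ′ → WellFormed φ″ →
          φ ⇒*BVA φ′ → φ′ ≅[ NewVars φ φ′ ] φ″ → φ ⇒*BVA φ″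
lemma40 φ φ′ φ″ _ _ _ φ⇒*φ′ (S , S⊆W , φ″≈flipφ′) =
  ⇒*BVA-resp-≈ᶠ (⇒*BVA-flip S (λ x Sx → proj₂ (S⊆W x Sx)) φ⇒*φ′) (≈ᶠ-sym φ″≈flipφ′)
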